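{- Let $\le_s$ be the relation generated by the subtyping rules (refl), (size) and (prod) only. Then $T\le U$ if and only if there exist $T'$ and $U'$ such that $T\to^*T'$, $T'\le_s U'$ and $U\to^*U'$. Furthermore, if $T$ and $U$ are weakly normalizing, then $\mathrm{nf}(T)\le_s\mathrm{nf}(U)$, where $\mathrm{nf}(\cdot)$ denotes the (unique) normal form.
   Context: Sorts: $\mathcal S=\{\star,\Box\}$. Let $\mathcal X$ be a set of variables and $\mathcal F$ a set of symbols; a set $\mathcal R$ of rewrite rules is given, a symbol is defined if it heads the left-hand side of some rule and constant otherwise; $\mathcal{CF}^\Box$ denotes the constant symbols of sort $\Box$. Size expressions form a first-order term algebra $\mathcal A$ over size symbols and size variables, with a quasi-ordering $\le_{\mathcal A}$. Terms: $t::= s\mid x\mid C^a\mid f\mid [x:t]t\mid (x:t)t\mid tt$ with $s\in\mathcal S$, $C\in\mathcal{CF}^\Box$, $a\in\mathcal A$, $f\in\mathcal F\setminus\mathcal{CF}^\Box$. The reduction $\to$ is $\beta\cup\mathcal R$ closed under contexts and is assumed confluent; $\to^*$ is its reflexive-transitive closure and $T\downarrow U$ means $T$ and $U$ have a common reduct. Subtyping $\le$ is the smallest relation closed under: (refl) $T\le T$; (size) $C^a\vec t\le C^b\vec t$ when $C\in\mathcal{CF}^\Box$ and $a\le_{\mathcal A}b$; (prod) from $U'\le U$ and $V\le V'$ infer $(x:U)V\le(x:U')V'$; (conv) from $T'\le U'$, $T\downarrow T'$, $U'\downarrow U$ infer $T\le U$; (trans) from $T\le U$, $U\le V$ infer $T\le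 V$. -}

module Defs where

open import Data.Nat using (ℕ; zero; suc)
open import Data.List using (List; []; _∷_; foldl)
open import Data.Product using (Σ; ∃; _×_; _,_)
open import Relation.Nullary using (¬_)
open import Relation.Binary.PropositionalEquality using (_≡_)
open import Relation.Binary.Structures using (IsPreorder)
open import Relation.Binary.Construct.Closure.ReflexiveTransitive using (Star)

data Sort : Set where
  ⋆ □ : Sort

-- Raw syntax (de Bruijn indices for variables).
--   CB   : the symbols of CF^□ (constant symbols of sort □), which carry a size
--   FS   : the symbols of F \ CF^□
--   Size : the size algebra A
module Syntax (CB FS Size : Set) where

  data Term : Set where
    sort : Sort → Term
    var  : ℕ → Term
    csz  : CB → Size → Term
    sym  : FS → Term
    lam  : Term → Term → Term
    pi   : Term → Term → Term
    app  : Term → Term → Term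

  apps : Term → List Term → Term
  apps = foldl app

  ext : (ℕ → ℕ) → ℕ → ℕ
  ext ρ zero    = zero
  ext ρ (suc n) = suc (ρ n)

  rename : (ℕ → ℕ) → Term → Term
  rename ρ (sort s)  = sort s
  rename ρ (var n)   = var (ρ n)
  rename ρ (csz C a) = csz C a
  rename ρ (sym f)   = sym f
  rename ρ (lam A t) = lam (rename ρ A) (rename (ext ρ) t)
  rename ρ (pi A t)  = pi (rename ρ A) (rename (ext ρ) t)
  rename ρ (app t u) = app (rename ρ t) (rename ρ u)

  exts : (ℕ → Term) → ℕ → Term
  exts σ zero    = var zero
  exts σ (suc n) = rename suc (σ n)

  subst : (ℕ → Term) → Term → Term
  subst σ (sort s)  = sort s
  subst σ (var n)   = σ n
  subst σ (csz C a) = csz C a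
  subst σ (sym f)   = sym f
  subst σ (lam A t) = lam (subst σ A) (subst (exts σ) t)
  subst σ (pi A t)  = pi (subst σ A) (subst (exts σ) t)
  subst σ (app t u) = app (subst σ t) (subst σ u)

  sub0 : Term → ℕ → Term
  sub0 u zero    = u
  sub0 u (suc n) = var n

  _[_] : Term → Term → Term
  t [ u ] = subst (sub0 u) t

  HeadedBySym : Term → Set
  HeadedBySym l = Σ FS λ f → Σ (List Term) λ ts → l ≡ apps (sym f) ts

-- Since every lhs is headed by a symbol of FS, the symbols of CB are constant.
record Setting : Set₁ where
  field
    CB FS Size : Set
    _≤A_       : Size → Size → Set
    ≤A-quasi   : IsPreorder _≡_ _≤A_
    Rule       : Syntax.Term CB FS Size → Syntax.Term CB FS Size → Set
    lhs-headed : ∀ {l r} → Rule l r → Syntax.HeadedBySym CB FS Size l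

module Theory (𝒮 : Setting) where
  open Setting 𝒮 public
  open Syntax CB FS Size public

  infix 4 _⟶_
  data _⟶_ : Term → Term → Set where
    beta  : ∀ {A t u} → app (lam A t) u ⟶ t [ u ]
    rule  : ∀ {l r} → Rule l r → (σ : ℕ → Term) → subst σ l ⟶ subst σ r
    lamL  : ∀ {A A' t} → A ⟶ A' → lam A t ⟶ lam A' t
    lamR  : ∀ {A t t'} → t ⟶ t' → lam A t ⟶ lam A t'
    piL   : ∀ {A A' t} → A ⟶ A' → pi A t ⟶ pi A' t
    piR   : ∀ {A t t'} → t ⟶ t' → pi A t ⟶ pi A t'
    appL  : ∀ {t t' u} → t ⟶ t' → app t u ⟶ app t' u
    appR  : ∀ {t u u'} → u ⟶ u' → app t u ⟶ app t u'

  infix 4 _⟶*_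
  _⟶*_ : Term → Term → Set
  _⟶*_ = Star _⟶_

  infix 4 _↓_
  _↓_ : Term → Term → Set
  T ↓ U = ∃ λ V → (T ⟶* V) × (U ⟶* V)

  Confluent : Set
  Confluent = ∀ {T U V} → T ⟶* U → T ⟶* V → U ↓ V

  Normal : Term → Set
  Normal T = ¬ (∃ λ U → T ⟶ U)

  infix 4 _≤_
  data _≤_ : Term → Term → Set where
    refl  : ∀ {T} → T ≤ T
    size  : ∀ {C a b} (ts : List Term) → a ≤A b → apps (csz C a) ts ≤ apps (csz C b) ts
    prod  : ∀ {U U' V V'} → U' ≤ U → V ≤ V' → pi U V ≤ pi U' V'
    conv  : ∀ {T T' U U'} → T' ≤ U' → T ↓ T' → U' ↓ U → T ≤ U
    trans : ∀ {T U V} → T ≤ U → U ≤ V → T ≤ V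

  infix 4 _≤s_
  data _≤s_ : Term → Term → Set where
    refl  : ∀ {T} → T ≤s T
    size  : ∀ {C a b} (ts : List Term) → a ≤A b → apps (csz C a) ts ≤s apps (csz C b) ts
    prod  : ∀ {U U' V V'} → U' ≤s U → V ≤s V' → pi U V ≤s pi U' V'

-- Call T ≼ U the relation ≤s with its (size) rule read off the spine of an application.
-- Rewrite rules have left-hand sides headed by symbols of F \ CF^□, which ≼ relates only
-- reflexively, so every reduction step on one side of T ≼ U is matched by a step on the
-- other: ≼ is a simulation. Hence "T and U reduce to T' ≼ U'" is transitive (by confluence
-- and transitivity of ≼) and contains ↓, so it is closed under all the rules of ≤; the
-- converse is a single (conv). For normal forms the reducts in that relation must be the
-- normal forms themselves.
module Submission where

open import Defs
open import Data.Empty using (⊥; ⊥-elim)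
open import Data.List using ([]; _∷_; _++_)
open import Data.List.Properties using (foldl-++)
open import Data.Product using (∃; ∃₂; _×_; _,_)
open import Function using (flip)
open import Function.Bundles using (_⇔_; mk⇔)
open import Relation.Binary.Construct.Closure.ReflexiveTransitive
  using (Star; ε; _◅_; _◅◅_; gmap)
open import Relation.Binary.PropositionalEquality as ≡ using (_≡_; refl)
open import Relation.Binary.Structures using (IsPreorder)

star-simulation : ∀ {A : Set} {_⟶_ R : A → A → Set} →
  (∀ {T U T₁} → T ⟶ T₁ → R T U → ∃ λ U₁ → U ⟶ U₁ × R T₁ U₁) →
  ∀ {T U T₁} → Star _⟶_ T T₁ → R T U → ∃ λ U₁ → Star _⟶_ U U₁ × R T₁ U₁
star-simulation step ε       h = _ , ε , h
star-simulation step (r ◅ rs) h with step r h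
... | _ , r′ , h′ with star-simulation step rs h′
...   | U₂ , rs′ , h″ = U₂ , r′ ◅ rs′ , h″

module Subtyping (𝒮 : Setting) where
  open Theory 𝒮

  data SymHeaded : Term → Set where
    symbol : ∀ {f} → SymHeaded (sym f)
    app    : ∀ {t u} → SymHeaded t → SymHeaded (app t u)

  symHeaded-apps : ∀ {t} ts → SymHeaded t → SymHeaded (apps t ts)
  symHeaded-apps []       h = h
  symHeaded-apps (_ ∷ ts) h = symHeaded-apps ts (app h)

  symHeaded-subst : ∀ {t} σ → SymHeaded t → SymHeaded (subst σ t)
  symHeaded-subst σ symbol  = symbol
  symHeaded-subst σ (app h) = app (symHeaded-subst σ h)

  rule-lhs-symHeaded : ∀ {l r} → Rule l r → ∀ σ → SymHeaded (subst σ l)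
  rule-lhs-symHeaded ρ σ with lhs-headed ρ
  ... | _ , ts , refl = symHeaded-subst σ (symHeaded-apps ts symbol)

  infix 4 _≤size_
  data _≤size_ : Term → Term → Set where
    csz : ∀ {C a b} → a ≤A b → csz C a ≤size csz C b
    app : ∀ {t t′ u} → t ≤size t′ → app t u ≤size app t′ u

  ≤size-apps : ∀ {t t′} ts → t ≤size t′ → apps t ts ≤size apps t′ ts
  ≤size-apps []       s = s
  ≤size-apps (_ ∷ ts) s = ≤size-apps ts (app s)

  ≤size-trans : ∀ {X Y Z} → X ≤size Y → Y ≤size Z → X ≤size Z
  ≤size-trans (csz p) (csz q) = csz (IsPreorder.trans ≤A-quasi p q)
  ≤size-trans (app s) (app t) = app (≤size-trans s t)

  ≤size-symHeadedˡ : ∀ {X Y} → SymHeaded X → X ≤size Y → ⊥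
  ≤size-symHeadedˡ (app h) (app s) = ≤size-symHeadedˡ h s

  ≤size-symHeadedʳ : ∀ {X Y} → SymHeaded Y → X ≤size Y → ⊥
  ≤size-symHeadedʳ (app h) (app s) = ≤size-symHeadedʳ h s

  data SizeSpine : Term → Term → Set where
    spine : ∀ {C a b} ts → a ≤A b → SizeSpine (apps (csz C a) ts) (apps (csz C b) ts)

  ≤size-spine : ∀ {X Y} → X ≤size Y → SizeSpine X Y
  ≤size-spine (csz p) = spine [] p
  ≤size-spine (app {u = u} s) with ≤size-spine s
  ... | spine {C} {a} {b} ts p
    rewrite ≡.sym (foldl-++ app (csz C a) ts (u ∷ []))
          | ≡.sym (foldl-++ app (csz C b) ts (u ∷ [])) = spine (ts ++ u ∷ []) p

  ≤size⇒≤s : ∀ {X Y} → X ≤size Y → X ≤s Y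
  ≤size⇒≤s s with ≤size-spine s
  ... | spine ts p = size ts p

  ≤size-stepˡ : ∀ {X Y X₁} → X ⟶ X₁ → X ≤size Y → ∃ λ Y₁ → Y ⟶ Y₁ × X₁ ≤size Y₁
  ≤size-stepˡ beta       (app ())
  ≤size-stepˡ (rule ρ σ) s       = ⊥-elim (≤size-symHeadedˡ (rule-lhs-symHeaded ρ σ) s)
  ≤size-stepˡ (appL r)   (app s) with ≤size-stepˡ r s
  ... | _ , r′ , s′ = _ , appL r′ , app s′
  ≤size-stepˡ (appR r)   (app s) = _ , appR r , app s

  ≤size-stepʳ : ∀ {X Y Y₁} → Y ⟶ Y₁ → X ≤size Y → ∃ λ X₁ → X ⟶ X₁ × X₁ ≤size Y₁
  ≤size-stepʳ beta       (app ())
  ≤size-stepʳ (rule ρ σ) s       = ⊥-elim (≤size-symHeadedʳ (rule-lhs-symHeaded ρ σ) s)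
  ≤size-stepʳ (appL r)   (app s) with ≤size-stepʳ r s
  ... | _ , r′ , s′ = _ , appL r′ , app s′
  ≤size-stepʳ (appR r)   (app s) = _ , appR r , app s

  infix 4 _≼_
  data _≼_ : Term → Term → Set where
    refl : ∀ {T} → T ≼ T
    size : ∀ {T U} → T ≤size U → T ≼ U
    prod : ∀ {U U′ V V′} → U′ ≼ U → V ≼ V′ → pi U V ≼ pi U′ V′

  ≼-trans : ∀ {X Y Z} → X ≼ Y → Y ≼ Z → X ≼ Z
  ≼-trans refl       q          = q
  ≼-trans p          refl       = p
  ≼-trans (size s)   (size t)   = size (≤size-trans s t)
  ≼-trans (prod a b) (prod c d) = prod (≼-trans c a) (≼-trans b d)

  ≼⇒≤s : ∀ {T U} → T ≼ U → T ≤s U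
  ≼⇒≤s refl       = refl
  ≼⇒≤s (size s)   = ≤size⇒≤s s
  ≼⇒≤s (prod p q) = prod (≼⇒≤s p) (≼⇒≤s q)

  ≤s⇒≤ : ∀ {T U} → T ≤s U → T ≤ U
  ≤s⇒≤ refl        = refl
  ≤s⇒≤ (size ts p) = size ts p
  ≤s⇒≤ (prod p q)  = prod (≤s⇒≤ p) (≤s⇒≤ q)

  ≼-symHeadedˡ : ∀ {T U} → SymHeaded T → T ≼ U → T ≡ U
  ≼-symHeadedˡ h refl     = refl
  ≼-symHeadedˡ h (size s) = ⊥-elim (≤size-symHeadedˡ h s)

  ≼-symHeadedʳ : ∀ {T U} → SymHeaded U → T ≼ U → T ≡ U
  ≼-symHeadedʳ h refl     = refl
  ≼-symHeadedʳ h (size s) = ⊥-elim (≤size-symHeadedʳ h s)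

  ≼-stepˡ : ∀ {T U T₁} → T ⟶ T₁ → T ≼ U → ∃ λ U₁ → U ⟶ U₁ × T₁ ≼ U₁
  ≼-stepʳ : ∀ {T U U₁} → U ⟶ U₁ → T ≼ U → ∃ λ T₁ → T ⟶ T₁ × T₁ ≼ U₁

  ≼-stepˡ (rule ρ σ) h with ≼-symHeadedˡ (rule-lhs-symHeaded ρ σ) h
  ... | refl = _ , rule ρ σ , refl
  ≼-stepˡ r refl = _ , r , refl
  ≼-stepˡ r (size s) with ≤size-stepˡ r s
  ... | _ , r′ , s′ = _ , r′ , size s′
  ≼-stepˡ (piL r) (prod p q) with ≼-stepʳ r p
  ... | _ , r′ , p′ = _ , piL r′ , prod p′ q
  ≼-stepˡ (piR r) (prod p q) with ≼-stepˡ r q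
  ... | _ , r′ , q′ = _ , piR r′ , prod p q′

  ≼-stepʳ (rule ρ σ) h with ≼-symHeadedʳ (rule-lhs-symHeaded ρ σ) h
  ... | refl = _ , rule ρ σ , refl
  ≼-stepʳ r refl = _ , r , refl
  ≼-stepʳ r (size s) with ≤size-stepʳ r s
  ... | _ , r′ , s′ = _ , r′ , size s′
  ≼-stepʳ (piL r) (prod p q) with ≼-stepˡ r p
  ... | _ , r′ , p′ = _ , piL r′ , prod p′ q
  ≼-stepʳ (piR r) (prod p q) with ≼-stepʳ r q
  ... | _ , r′ , q′ = _ , piR r′ , prod p q′

  ≼-starˡ : ∀ {T U T₁} → T ⟶* T₁ → T ≼ U → ∃ λ U₁ → U ⟶* U₁ × T₁ ≼ U₁
  ≼-starˡ = star-simulation ≼-stepˡ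

  ≼-starʳ : ∀ {T U U₁} → U ⟶* U₁ → T ≼ U → ∃ λ T₁ → T ⟶* T₁ × T₁ ≼ U₁
  ≼-starʳ = star-simulation {R = flip _≼_} ≼-stepʳ

  normal-⟶*-≡ : ∀ {X Y} → Normal X → X ⟶* Y → X ≡ Y
  normal-⟶*-≡ n ε       = refl
  normal-⟶*-≡ n (r ◅ _) = ⊥-elim (n (_ , r))

  pi-⟶* : ∀ {A A′ B B′} → A ⟶* A′ → B ⟶* B′ → pi A B ⟶* pi A′ B′
  pi-⟶* rs qs = gmap (λ A → pi A _) piL rs ◅◅ gmap (pi _) piR qs

  JoinableBy : (Term → Term → Set) → Term → Term → Set
  JoinableBy R T U = ∃₂ λ T′ U′ → T ⟶* T′ × R T′ U′ × U ⟶* U′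

  joinableBy-map : ∀ {R S} → (∀ {T U} → R T U → S T U) →
                   ∀ {T U} → JoinableBy R T U → JoinableBy S T U
  joinableBy-map f (T′ , U′ , TT′ , h , UU′) = T′ , U′ , TT′ , f h , UU′

  infix 4 _≼↓_
  _≼↓_ : Term → Term → Set
  _≼↓_ = JoinableBy _≼_

  ↓⇒≼↓ : ∀ {T U} → T ↓ U → T ≼↓ U
  ↓⇒≼↓ (V , TV , UV) = V , V , TV , refl , UV

  ≼↓-pi : ∀ {A A′ B B′} → A′ ≼↓ A → B ≼↓ B′ → pi A B ≼↓ pi A′ B′
  ≼↓-pi (_ , _ , A′C , CD , AD) (_ , _ , BE , EF , B′F) =
    _ , _ , pi-⟶* AD BE , prod CD EF , pi-⟶* A′C B′F

  module _ (confluent : Confluent) where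

    ≼↓-trans : ∀ {T U V} → T ≼↓ U → U ≼↓ V → T ≼↓ V
    ≼↓-trans (_ , _ , TA , AB , UB) (_ , _ , UC , CD , VD) with confluent UB UC
    ... | _ , BE , CE with ≼-starʳ BE AB | ≼-starˡ CE CD
    ...   | _ , AA′ , A′E | _ , DD′ , ED′ =
      _ , _ , TA ◅◅ AA′ , ≼-trans A′E ED′ , VD ◅◅ DD′

    ≤⇒≼↓ : ∀ {T U} → T ≤ U → T ≼↓ U
    ≤⇒≼↓ refl           = ↓⇒≼↓ (_ , ε , ε)
    ≤⇒≼↓ (size ts p)    = _ , _ , ε , size (≤size-apps ts (csz p)) , ε
    ≤⇒≼↓ (prod h k)     = ≼↓-pi (≤⇒≼↓ h) (≤⇒≼↓ k)
    ≤⇒≼↓ (conv h T↓ ↓U) = ≼↓-trans (↓⇒≼↓ T↓) (≼↓-trans (≤⇒≼↓ h) (↓⇒≼↓ ↓U))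
    ≤⇒≼↓ (trans h k)    = ≼↓-trans (≤⇒≼↓ h) (≤⇒≼↓ k)

    ≼↓-reducts : ∀ {T U T′ U′} → T ≼↓ U → T ⟶* T′ → U ⟶* U′ → T′ ≼↓ U′
    ≼↓-reducts h TT′ UU′ = ≼↓-trans (↓⇒≼↓ (_ , ε , TT′)) (≼↓-trans h (↓⇒≼↓ (_ , UU′ , ε)))

    ≤⇒joinableBy-≤s : ∀ {T U} → T ≤ U → JoinableBy _≤s_ T U
    ≤⇒joinableBy-≤s h = joinableBy-map ≼⇒≤s (≤⇒≼↓ h)

    ≤-normal-forms : ∀ {T U T′ U′} → T ≤ U → T ⟶* T′ → Normal T′ → U ⟶* U′ → Normal U′ →
                     T′ ≤s U′
    ≤-normal-forms h TT′ nT′ UU′ nU′ with ≼↓-reducts (≤⇒≼↓ h) TT′ UU′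
    ... | _ , _ , T′A , AB , U′B
      rewrite normal-⟶*-≡ nT′ T′A | normal-⟶*-≡ nU′ U′B = ≼⇒≤s AB

  joinableBy-≤s⇒≤ : ∀ {T U} → JoinableBy _≤s_ T U → T ≤ U
  joinableBy-≤s⇒≤ (T′ , U′ , TT′ , h , UU′) = conv (≤s⇒≤ h) (T′ , TT′ , ε) (U′ , ε , UU′)

mainTheorem5 : (𝒮 : Setting) → Theory.Confluent 𝒮 →
    (∀ T U → Theory._≤_ 𝒮 T U ⇔ (∃₂ λ T' U' → Theory._⟶*_ 𝒮 T T' × Theory._≤s_ 𝒮 T' U' × Theory._⟶*_ 𝒮 U U'))
    × (∀ T U T' U' → Theory._≤_ 𝒮 T U → Theory._⟶*_ 𝒮 T T' → Theory.Normal 𝒮 T' → Theory._⟶*_ 𝒮 U U' → Theory.Normal 𝒮 U' → Theory._≤s_ 𝒮 T' U')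
mainTheorem5 𝒮 confluent =
  (λ _ _ → mk⇔ (≤⇒joinableBy-≤s confluent) joinableBy-≤s⇒≤) ,
  (λ _ _ _ _ → ≤-normal-forms confluent)
  where open Subtyping 𝒮
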